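{- Let $p$ be a prime and $b_1,b_2,b_3,b_4\in\mathbb F_p^\times$ satisfy \[ b_1+b_2=b_3+b_4,\qquad \bar b_1+\bar b_2=\bar b_3+\bar b_4 \] in $\mathbb F_p$. Then $(b_1^2,b_2^2,b_3^2,b_4^2)\in\mathcal V^\Delta$.
   Context: $\bar b$ denotes the inverse of $b$ in $\mathbb F_p$. $\mathcal V^\Delta\subset\mathbb F_p^4$ is the set of $(c_1,c_2,c_3,c_4)$ such that for every $i\in\{1,2,3,4\}$ the number of $j\in\{1,2,3,4\}$ with $c_j=c_i$ is even. -}

module Defs where

open import Data.Nat as ℕ using (ℕ)
open import Data.Nat.Divisibility using (_∣?_) renaming (_∣_ to _∣ℕ_)
open import Data.Integer using (ℤ; _-_; ∣_∣)
open import Data.Fin using (Fin)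
open import Data.List using (length; filter; allFin)
open import Relation.Nullary using (Dec)
open import Relation.Unary using (Pred)

-- Elements of 𝔽_p are represented by integers; equality in 𝔽_p is
-- congruence modulo p.
_≡_[mod_] : ℤ → ℤ → ℕ → Set
a ≡ b [mod p ] = p ∣ℕ ∣ a - b ∣

_≡?_[mod_] : (a b : ℤ) (p : ℕ) → Dec (a ≡ b [mod p ])
a ≡? b [mod p ] = p ∣? ∣ a - b ∣

multiplicity : ℕ → (Fin 4 → ℤ) → Fin 4 → ℕ
multiplicity p c i = length (filter (λ j → c j ≡? c i [mod p ]) (allFin 4))

data Even : ℕ → Set where
  even0 : Even 0
  even+2 : ∀ {n} → Even n → Even (ℕ.suc (ℕ.suc n))

𝒱Δ : ℕ → Pred (Fin 4 → ℤ) _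
𝒱Δ p c = ∀ (i : Fin 4) → Even (multiplicity p c i)

-- Clearing denominators in b̄₁ + b̄₂ = b̄₃ + b̄₄ and eliminating b₄ with
-- b₁ + b₂ = b₃ + b₄ leaves (b₁ + b₂)(b₁ − b₃)(b₁ − b₄) = 0.  In 𝔽_p one factor
-- vanishes, and the linear relation then forces b₃ = −b₄, b₂ = b₄ or b₂ = b₃
-- respectively.  Either way the four values b_i fall into two pairs that agree
-- up to sign, so their squares fall into two pairs of equal values.
module Submission where

open import Defs
open import Data.Nat using (ℕ)
open import Data.Nat.Divisibility using () renaming (_∣_ to _∣ℕ_)
open import Data.Nat.Primality using (Prime; euclidsLemma)
open import Data.Integer as ℤ using (ℤ; +_; -_; _+_; _-_; _*_; 1ℤ; 0ℤ)
open import Data.Integer.Properties using (abs-*)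
open import Data.Integer.Divisibility.Signed
  using (_∣_; ∣ᵤ⇒∣; ∣⇒∣ᵤ; ∣m⇒∣-m; ∣m∣n⇒∣m+n; ∣m∣n⇒∣m-n; ∣n⇒∣m*n)
open import Data.Integer.Tactic.RingSolver using (solve-∀)
open import Data.Fin using (Fin; zero; suc)
open import Data.List using ([]; _∷_; length; filter)
open import Data.List.Relation.Binary.Permutation.Propositional using (_↭_; refl; prep; swap; trans)
open import Data.List.Relation.Binary.Permutation.Propositional.Properties using (↭-length; filter-↭)
open import Data.Sum as Sum using (_⊎_; inj₁; inj₂)
open import Data.Empty using (⊥-elim)
open import Function.Base using (_∘_)
open import Function.Bundles using (_⇔_; Equivalence; mk⇔)
open import Relation.Nullary using (¬_; yes; no)
open import Relation.Unary using (Pred; Decidable)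
open import Relation.Binary.Core using (Rel)
open import Relation.Binary.PropositionalEquality using (_≡_; subst)

private
  variable
    x y z : ℤ

module _ {a p} {A : Set a} {P : Pred A p} (P? : Decidable P) where

  Even-filter-pair : ∀ {x y xs} → P x ⇔ P y →
    Even (length (filter P? xs)) → Even (length (filter P? (x ∷ y ∷ xs)))
  Even-filter-pair {x} {y} Px⇔Py ev with P? x
  ... | yes Px with P? y
  ...   | yes _  = even+2 ev
  ...   | no ¬Py = ⊥-elim (¬Py (Equivalence.to Px⇔Py Px))
  Even-filter-pair {x} {y} Px⇔Py ev | no ¬Px with P? y
  ...   | yes Py = ⊥-elim (¬Px (Equivalence.from Px⇔Py Py))
  ...   | no _   = ev

  Even-filter-↭ : ∀ {xs ys} → xs ↭ ys →
    Even (length (filter P? xs)) → Even (length (filter P? ys))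
  Even-filter-↭ xs↭ys = subst Even (↭-length (filter-↭ P? xs↭ys))

  Even-filter-pairs : ∀ {w x y z} → P w ⇔ P x → P y ⇔ P z →
    Even (length (filter P? (w ∷ x ∷ y ∷ z ∷ [])))
  Even-filter-pairs w⇔x y⇔z = Even-filter-pair w⇔x (Even-filter-pair y⇔z even0)

pattern 0F = zero
pattern 1F = suc zero
pattern 2F = suc (suc zero)
pattern 3F = suc (suc (suc zero))

data PairsUp {a ℓ} {A : Set a} (_≈_ : Rel A ℓ) (c : Fin 4 → A) : Set ℓ where
  01∣23 : c 0F ≈ c 1F → c 2F ≈ c 3F → PairsUp _≈_ c
  02∣13 : c 0F ≈ c 2F → c 1F ≈ c 3F → PairsUp _≈_ c
  03∣12 : c 0F ≈ c 3F → c 1F ≈ c 2F → PairsUp _≈_ c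

PairsUp-map : ∀ {a b ℓ ℓ′} {A : Set a} {B : Set b} {R : Rel A ℓ} {S : Rel B ℓ′}
  {c : Fin 4 → A} (f : A → B) → (∀ {u v} → R u v → S (f u) (f v)) →
  PairsUp R c → PairsUp S (λ i → f (c i))
PairsUp-map f f-cong (01∣23 r s) = 01∣23 (f-cong r) (f-cong s)
PairsUp-map f f-cong (02∣13 r s) = 02∣13 (f-cong r) (f-cong s)
PairsUp-map f f-cong (03∣12 r s) = 03∣12 (f-cong r) (f-cong s)

_≡±_[mod_] : ℤ → ℤ → ℕ → Set
x ≡± y [mod n ] = + n ∣ x - y ⊎ + n ∣ x + y

module _ {n : ℕ} where

  mod⇒∣ : x ≡ y [mod n ] → + n ∣ x - y
  mod⇒∣ = ∣ᵤ⇒∣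

  ∣⇒mod : + n ∣ x - y → x ≡ y [mod n ]
  ∣⇒mod = ∣⇒∣ᵤ

  mod-sym : x ≡ y [mod n ] → y ≡ x [mod n ]
  mod-sym {x} {y} x≡y =
    ∣⇒mod {y} {x} (subst (+ n ∣_) (-[x-y]≡y-x x y) (∣m⇒∣-m (mod⇒∣ {x} {y} x≡y)))
    where
    -[x-y]≡y-x : ∀ x y → - (x - y) ≡ y - x
    -[x-y]≡y-x = solve-∀

  mod-trans : x ≡ y [mod n ] → y ≡ z [mod n ] → x ≡ z [mod n ]
  mod-trans {x} {y} {z} x≡y y≡z =
    ∣⇒mod {x} {z} (subst (+ n ∣_) (telescope x y z)
      (∣m∣n⇒∣m+n (mod⇒∣ {x} {y} x≡y) (mod⇒∣ {y} {z} y≡z)))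
    where
    telescope : ∀ x y z → (x - y) + (y - z) ≡ x - z
    telescope = solve-∀

  PairsUp⇒𝒱Δ : ∀ {c} → PairsUp (_≡_[mod n ]) c → 𝒱Δ n c
  PairsUp⇒𝒱Δ {c} pairs i = Even-count pairs
    where
    c≡?cᵢ : Decidable (λ j → c j ≡ c i [mod n ])
    c≡?cᵢ j = c j ≡? c i [mod n ]

    agree : ∀ {j k} → c j ≡ c k [mod n ] → (c j ≡ c i [mod n ]) ⇔ (c k ≡ c i [mod n ])
    agree {j} {k} cj≡ck =
      mk⇔ (mod-trans {c k} {c j} {c i} (mod-sym {c j} {c k} cj≡ck)) (mod-trans {c j} {c k} {c i} cj≡ck)

    Even-count : PairsUp (_≡_[mod n ]) c → Even (length (filter c≡?cᵢ (0F ∷ 1F ∷ 2F ∷ 3F ∷ [])))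
    Even-count (01∣23 c₀≡c₁ c₂≡c₃) = Even-filter-pairs c≡?cᵢ (agree c₀≡c₁) (agree c₂≡c₃)
    Even-count (02∣13 c₀≡c₂ c₁≡c₃) =
      Even-filter-↭ c≡?cᵢ (prep 0F (swap 2F 1F refl))
        (Even-filter-pairs c≡?cᵢ (agree c₀≡c₂) (agree c₁≡c₃))
    Even-count (03∣12 c₀≡c₃ c₁≡c₂) =
      Even-filter-↭ c≡?cᵢ
        (prep 0F (trans (swap 3F 1F refl) (prep 1F (swap 3F 2F refl))))
        (Even-filter-pairs c≡?cᵢ (agree c₀≡c₃) (agree c₁≡c₂))

  ≡±⇒square≡ : x ≡± y [mod n ] → (x * x) ≡ (y * y) [mod n ]
  ≡±⇒square≡ {x} {y} (inj₁ n∣x-y) =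
    ∣⇒mod {x * x} {y * y} (subst (+ n ∣_) ([x+y][x-y]≡x²-y² x y) (∣n⇒∣m*n (x + y) n∣x-y))
    where
    [x+y][x-y]≡x²-y² : ∀ x y → (x + y) * (x - y) ≡ x * x - y * y
    [x+y][x-y]≡x²-y² = solve-∀
  ≡±⇒square≡ {x} {y} (inj₂ n∣x+y) =
    ∣⇒mod {x * x} {y * y} (subst (+ n ∣_) ([x-y][x+y]≡x²-y² x y) (∣n⇒∣m*n (x - y) n∣x+y))
    where
    [x-y][x+y]≡x²-y² : ∀ x y → (x - y) * (x + y) ≡ x * x - y * y
    [x-y][x+y]≡x²-y² = solve-∀

  equal-sums⇒∣[x₀+x₁][x₀-x₂][x₀-x₃] : (x y : Fin 4 → ℤ) →
    (∀ i → (x i * y i) ≡ 1ℤ [mod n ]) →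
    (x 0F + x 1F) ≡ (x 2F + x 3F) [mod n ] → (y 0F + y 1F) ≡ (y 2F + y 3F) [mod n ] →
    + n ∣ (x 0F + x 1F) * (x 0F - x 2F) * (x 0F - x 3F)
  equal-sums⇒∣[x₀+x₁][x₀-x₂][x₀-x₃] x y xy≡1 x-sums y-sums =
    subst (+ n ∣_) (certificate (x 0F) (x 1F) (x 2F) (x 3F) (y 0F) (y 1F) (y 2F) (y 3F))
      (∣m∣n⇒∣m+n (∣m∣n⇒∣m+n (∣m∣n⇒∣m+n (∣m∣n⇒∣m-n (∣m∣n⇒∣m-n
        (∣n⇒∣m*n (x 0F * x 1F * x 2F * x 3F) n∣t)
        (∣n⇒∣m*n (x 1F * x 2F * x 3F) (n∣e 0F)))
        (∣n⇒∣m*n (x 0F * x 2F * x 3F) (n∣e 1F)))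
        (∣n⇒∣m*n (x 0F * x 1F * x 3F) (n∣e 2F)))
        (∣n⇒∣m*n (x 0F * x 1F * x 2F) (n∣e 3F)))
        (∣n⇒∣m*n (x 0F * x 0F) n∣s))
    where
    n∣e : ∀ i → + n ∣ x i * y i - 1ℤ
    n∣e i = mod⇒∣ {x i * y i} {1ℤ} (xy≡1 i)

    n∣s : + n ∣ (x 0F + x 1F) - (x 2F + x 3F)
    n∣s = mod⇒∣ {x 0F + x 1F} {x 2F + x 3F} x-sums

    n∣t : + n ∣ (y 0F + y 1F) - (y 2F + y 3F)
    n∣t = mod⇒∣ {y 0F + y 1F} {y 2F + y 3F} y-sums

    -- x₀x₁x₂x₃ times the inverse relation, corrected by the xᵢyᵢ − 1, is the cleared
    -- relation x₁x₂x₃ + x₀x₂x₃ − x₀x₁x₃ − x₀x₁x₂; adding x₀² times the linear relation factors it.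
    certificate : ∀ x₀ x₁ x₂ x₃ y₀ y₁ y₂ y₃ →
      x₀ * x₁ * x₂ * x₃ * ((y₀ + y₁) - (y₂ + y₃))
        - x₁ * x₂ * x₃ * (x₀ * y₀ - 1ℤ) - x₀ * x₂ * x₃ * (x₁ * y₁ - 1ℤ)
        + x₀ * x₁ * x₃ * (x₂ * y₂ - 1ℤ) + x₀ * x₁ * x₂ * (x₃ * y₃ - 1ℤ)
        + x₀ * x₀ * ((x₀ + x₁) - (x₂ + x₃))
      ≡ (x₀ + x₁) * (x₀ - x₂) * (x₀ - x₃)
    certificate = solve-∀

  euclidsLemmaℤ : Prime n → ∀ x y → + n ∣ x * y → + n ∣ x ⊎ + n ∣ y
  euclidsLemmaℤ n-prime x y n∣xy =
    Sum.map ∣ᵤ⇒∣ ∣ᵤ⇒∣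
      (euclidsLemma ℤ.∣ x ∣ ℤ.∣ y ∣ n-prime (subst (n ∣ℕ_) (abs-* x y) (∣⇒∣ᵤ n∣xy)))

  prime∣[x₀+x₁][x₀-x₂][x₀-x₃]⇒PairsUp : Prime n → (x : Fin 4 → ℤ) →
    (x 0F + x 1F) ≡ (x 2F + x 3F) [mod n ] →
    + n ∣ (x 0F + x 1F) * (x 0F - x 2F) * (x 0F - x 3F) →
    PairsUp (_≡±_[mod n ]) x
  prime∣[x₀+x₁][x₀-x₂][x₀-x₃]⇒PairsUp n-prime x sums n∣product =
    Sum.[ Sum.[ pairs₀₁ , pairs₀₂ ] ∘ euclidsLemmaℤ n-prime (x 0F + x 1F) (x 0F - x 2F)
        , pairs₀₃ ]
      (euclidsLemmaℤ n-prime ((x 0F + x 1F) * (x 0F - x 2F)) (x 0F - x 3F) n∣product)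
    where
    n∣s : + n ∣ (x 0F + x 1F) - (x 2F + x 3F)
    n∣s = mod⇒∣ {x 0F + x 1F} {x 2F + x 3F} sums

    pairs₀₁ : + n ∣ x 0F + x 1F → PairsUp (_≡±_[mod n ]) x
    pairs₀₁ n∣x₀+x₁ =
      01∣23 (inj₂ n∣x₀+x₁) (inj₂ (subst (+ n ∣_) (cancel (x 0F) (x 1F) (x 2F) (x 3F)) (∣m∣n⇒∣m-n n∣x₀+x₁ n∣s)))
      where
      cancel : ∀ a b c d → (a + b) - ((a + b) - (c + d)) ≡ c + d
      cancel = solve-∀

    pairs₀₂ : + n ∣ x 0F - x 2F → PairsUp (_≡±_[mod n ]) x
    pairs₀₂ n∣x₀-x₂ =
      02∣13 (inj₁ n∣x₀-x₂) (inj₁ (subst (+ n ∣_) (cancel (x 0F) (x 1F) (x 2F) (x 3F)) (∣m∣n⇒∣m-n n∣s n∣x₀-x₂)))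
      where
      cancel : ∀ a b c d → ((a + b) - (c + d)) - (a - c) ≡ b - d
      cancel = solve-∀

    pairs₀₃ : + n ∣ x 0F - x 3F → PairsUp (_≡±_[mod n ]) x
    pairs₀₃ n∣x₀-x₃ =
      03∣12 (inj₁ n∣x₀-x₃) (inj₁ (subst (+ n ∣_) (cancel (x 0F) (x 1F) (x 2F) (x 3F)) (∣m∣n⇒∣m-n n∣s n∣x₀-x₃)))
      where
      cancel : ∀ a b c d → ((a + b) - (c + d)) - (a - d) ≡ b - c
      cancel = solve-∀

lemma6p4 : (p : ℕ) → Prime p → (b b̄ : Fin 4 → ℤ)
    → (∀ i → ¬ (b i ≡ 0ℤ [mod p ]))
    → (∀ i → (b i * b̄ i) ≡ 1ℤ [mod p ])
    → (b zero + b (suc zero)) ≡ (b (suc (suc zero)) + b (suc (suc (suc zero)))) [mod p ]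
    → (b̄ zero + b̄ (suc zero)) ≡ (b̄ (suc (suc zero)) + b̄ (suc (suc (suc zero)))) [mod p ]
    → 𝒱Δ p (λ i → b i * b i)
lemma6p4 p p-prime b b̄ _ b-inverses b-sums b̄-sums =
  PairsUp⇒𝒱Δ (PairsUp-map (λ x → x * x) (λ {x} {y} → ≡±⇒square≡ {p} {x} {y}) b-pairsUp)
  where
  b-pairsUp : PairsUp (_≡±_[mod p ]) b
  b-pairsUp = prime∣[x₀+x₁][x₀-x₂][x₀-x₃]⇒PairsUp p-prime b b-sums
    (equal-sums⇒∣[x₀+x₁][x₀-x₂][x₀-x₃] b b̄ b-inverses b-sums b̄-sums)
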